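{- Let $n>1$ be a power of an odd prime, and let $\varphi$ denote Euler's totient function. Then there are integers $a_1,a_2,\ldots,a_{\varphi(n)}$ such that both $$\{a_1,\ldots,a_{\varphi(n)}\}\quad\text{and}\quad\{a_1-a_2,\ a_2-a_3,\ \ldots,\ a_{\varphi(n)-1}-a_{\varphi(n)},\ a_{\varphi(n)}-a_1\}$$ are reduced systems of residues modulo $n$.
   Context: A reduced system of residues modulo $n$ is a set of $\varphi(n)$ integers, each coprime to $n$, that are pairwise incongruent modulo $n$. -}

module Defs where

open import Data.Nat as ℕ using (ℕ; zero; suc)
open import Data.Nat.GCD using (gcd)
open import Data.Nat.Coprimality using (Coprime)
open import Data.Integer as ℤ using (ℤ; ∣_∣)
open import Data.Integer.Divisibility as ℤDiv using ()
open import Data.Fin as Fin using (Fin)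
open import Data.List using (List; length; filter; upTo; map)
open import Relation.Binary.PropositionalEquality using (_≡_; _≢_)
open import Relation.Nullary using (¬_)
open import Data.Product using (_×_)

φ : ℕ → ℕ
φ n = length (filter (λ k → gcd k n ℕ.≟ 1) (map suc (upTo n)))

_≡_[mod_] : ℤ → ℤ → ℕ → Set
a ≡ b [mod n ] = ℤ.+ n ℤDiv.∣ (a ℤ.- b)

CoprimeTo : ℕ → ℤ → Set
CoprimeTo n a = Coprime ∣ a ∣ n

ReducedResidueSystem : (n : ℕ) → (Fin (φ n) → ℤ) → Set
ReducedResidueSystem n a =
  ((i : Fin (φ n)) → CoprimeTo n (a i)) ×
  ((i j : Fin (φ n)) → i ≢ j → ¬ (a i ≡ a j [mod n ]))

cyc-suc : {m : ℕ} → Fin m → Fin m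
cyc-suc {suc m} i with Fin.toℕ i ℕ.<? m
... | Relation.Nullary.yes p = Fin.fromℕ< (ℕ.s≤s p)
... | Relation.Nullary.no _ = Fin.zero

cyclicDiffs : {m : ℕ} → (Fin m → ℤ) → Fin m → ℤ
cyclicDiffs a i = a i ℤ.- a (cyc-suc i)

module Submission where

-- Write n = p q with q = p^(k-1), let g be a primitive root modulo p, and
-- index the φ(n) = q (p - 1) positions as j = i + s (p - 1) with
-- 0 ≤ i < p - 1 and 0 ≤ s < q.  Put aⱼ = g^i + p (i + 1) s.  Modulo p,
-- aⱼ ≡ g^i and aⱼ - aⱼ₊₁ ≡ g^i (1 - g), using g^(p-1) ≡ 1; these are units,
-- as g ≢ 1 because p ≠ 2, and they determine i.  For a fixed i, two values
-- (resp. two differences) differ by p c (s - s') with c = i + 1 (resp.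
-- c = -1, or c = p - 2 when the step wraps to the next s), which is coprime
-- to q; so they are incongruent modulo n as |s - s'| < q.

open import Defs
open import Data.Nat using (ℕ; _^_; _<_)
open import Data.Nat.Primality using (Prime)
open import Data.Integer using (ℤ)
open import Data.Fin using (Fin)
open import Data.Product using (Σ; _×_; ∃)
open import Relation.Binary.PropositionalEquality using (_≢_)

open import Data.Empty using (⊥-elim)
import Data.Fin as Fin
import Data.Fin.Properties as FinP
open import Data.Integer as ℤ using (+_; _+_; _-_; _*_; -_; ∣_∣; 0ℤ; 1ℤ)
open import Data.Integer.Divisibility.Signed as ℤD using ()
import Data.Integer.DivMod as ℤDM
import Data.Integer.Properties as ℤP
open import Data.Integer.Tactic.RingSolver using (solve-∀)
open import Data.List using ([]; _∷_; [_]; _++_; length; filter; map; upTo)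
import Data.List.Properties as LP
open import Data.List.Relation.Unary.All using ([]; _∷_)
open import Data.Nat as ℕ using (zero; suc; _≤_; z≤n; s≤s; NonZero)
open import Data.Nat.Coprimality as ℕC using (Coprime)
open import Data.Nat.Divisibility as ℕD using (divides)
import Data.Nat.DivMod as ℕDM
open import Data.Nat.GCD using (gcd; gcd-greatest)
open import Data.Nat.Induction using (<-rec)
open import Data.Nat.ListAction using (product)
open import Data.Nat.Primality using (euclidsLemma; prime⇒nonZero; prime⇒nonTrivial; prime⇒irreducible)
open import Data.Nat.Primality.Factorisation using (factorise; PrimeFactorisation)
import Data.Nat.Properties as ℕP
open import Algebra.Properties.CommutativeSemigroup ℕP.*-commutativeSemigroup using (xy∙z≈xz∙y)
open import Data.Product using (_,_; proj₁; proj₂)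
import Data.Sum
open import Data.Sum using (_⊎_; inj₁; inj₂)
open import Level using (0ℓ)
open import Relation.Binary.Bundles using (Setoid)
open import Relation.Binary.Definitions using (tri<; tri≈; tri>)
open import Relation.Binary.PropositionalEquality
  using (_≡_; refl; sym; trans; cong; cong₂; subst; subst₂; module ≡-Reasoning)
import Relation.Binary.Reasoning.Setoid
open import Relation.Binary.Structures using (IsEquivalence)
open import Relation.Nullary using (¬_; Dec; yes; no)
open import Relation.Nullary.Decidable using (_×-dec_)

-- Congruence of integers modulo a fixed natural number n, as a record
-- so that its two sides can be inferred from a proof.
module Congruence (n : ℕ) where

  infix 4 _≈_
  record _≈_ (a b : ℤ) : Set where
    constructor mk
    field divides-difference : + n ℤD.∣ a - b
  open _≈_ public

  -- Every congruence law below is "n divides some combination of known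
  -- multiples of n, and that combination is the required difference".
  from-≡ : ∀ {x a b} → + n ℤD.∣ x → x ≡ a - b → a ≈ b
  from-≡ d eq = mk (subst (+ n ℤD.∣_) eq d)

  ≡⇒≈ : ∀ {a b} → a ≡ b → a ≈ b
  ≡⇒≈ {a} refl = mk (ℤD.divides 0ℤ (ℤP.+-inverseʳ a))

  ≈-sym : ∀ {a b} → a ≈ b → b ≈ a
  ≈-sym {a} {b} (mk d) = from-≡ (ℤD.∣m⇒∣-m d) (negate a b)
    where negate : ∀ a b → - (a - b) ≡ b - a
          negate = solve-∀

  ≈-trans : ∀ {a b c} → a ≈ b → b ≈ c → a ≈ c
  ≈-trans {a} {b} {c} (mk d) (mk e) = from-≡ (ℤD.∣m∣n⇒∣m+n d e) (telescope a b c)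
    where telescope : ∀ a b c → (a - b) + (b - c) ≡ a - c
          telescope = solve-∀

  ≈-isEquivalence : IsEquivalence _≈_
  ≈-isEquivalence = record { refl = ≡⇒≈ refl ; sym = ≈-sym ; trans = ≈-trans }

  ≈-setoid : Setoid 0ℓ 0ℓ
  ≈-setoid = record { isEquivalence = ≈-isEquivalence }

  open IsEquivalence ≈-isEquivalence public using () renaming (refl to ≈-refl)

  +-cong : ∀ {a b c d} → a ≈ b → c ≈ d → a + c ≈ b + d
  +-cong {a} {b} {c} {d} (mk e) (mk f) = from-≡ (ℤD.∣m∣n⇒∣m+n e f) (regroup a b c d)
    where regroup : ∀ a b c d → (a - b) + (c - d) ≡ (a + c) - (b + d)
          regroup = solve-∀

  neg-cong : ∀ {a b} → a ≈ b → - a ≈ - b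
  neg-cong {a} {b} (mk e) = from-≡ (ℤD.∣m⇒∣-m e) (regroup a b)
    where regroup : ∀ a b → - (a - b) ≡ (- a) - (- b)
          regroup = solve-∀

  -‿cong : ∀ {a b c d} → a ≈ b → c ≈ d → a - c ≈ b - d
  -‿cong e f = +-cong e (neg-cong f)

  *-cong : ∀ {a b c d} → a ≈ b → c ≈ d → a * c ≈ b * d
  *-cong {a} {b} {c} {d} (mk e) (mk f) =
    from-≡ (ℤD.∣m∣n⇒∣m+n (ℤD.∣m⇒∣m*n c e) (ℤD.∣n⇒∣m*n b f)) (regroup a b c d)
    where regroup : ∀ a b c d → (a - b) * c + b * (c - d) ≡ a * c - b * d
          regroup = solve-∀

  ^-cong : ∀ {a b} k → a ≈ b → a ℤ.^ k ≈ b ℤ.^ k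
  ^-cong zero    e = ≈-refl
  ^-cong (suc k) e = *-cong e (^-cong k e)

  ≈0⇒∣ : ∀ {a} → a ≈ 0ℤ → + n ℤD.∣ a
  ≈0⇒∣ {a} (mk d) = subst (+ n ℤD.∣_) (ℤP.+-identityʳ a) d

  ∣⇒≈0 : ∀ {a} → + n ℤD.∣ a → a ≈ 0ℤ
  ∣⇒≈0 {a} d = from-≡ d (sym (ℤP.+-identityʳ a))

  ≈⇒-≈0 : ∀ {a b} → a ≈ b → a - b ≈ 0ℤ
  ≈⇒-≈0 (mk d) = ∣⇒≈0 d

  -≈0⇒≈ : ∀ {a b} → a - b ≈ 0ℤ → a ≈ b
  -≈0⇒≈ e = mk (≈0⇒∣ e)

  infix 4 _≈?_
  _≈?_ : ∀ a b → Dec (a ≈ b)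
  a ≈? b with + n ℤD.∣? a - b
  ... | yes d = yes (mk d)
  ... | no ¬d = no λ e → ¬d (divides-difference e)

  *n≈0 : ∀ x → x * + n ≈ 0ℤ
  *n≈0 x = ∣⇒≈0 (ℤD.divides x refl)

  ≡[mod]⇒≈ : ∀ {a b} → a ≡ b [mod n ] → a ≈ b
  ≡[mod]⇒≈ d = mk (ℤD.∣ᵤ⇒∣ d)

  <-incongruent : ∀ {a b} → b < a → a < n → ¬ + a ≈ + b
  <-incongruent {a} {b} b<a a<n (mk d) =
    ℕP.<⇒≱ (ℕP.≤-<-trans (ℕP.m∸n≤m a b) a<n) (ℕD.∣⇒≤ {{ℕ.>-nonZero (ℕP.m<n⇒0<n∸m b<a)}} n∣a∸b)
    where n∣a∸b : n ℕD.∣ a ℕ.∸ b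
          n∣a∸b = subst (n ℕD.∣_) (cong ∣_∣ (trans (ℤP.[+m]-[+n]≡m⊖n a b) (ℤP.⊖-≥ (ℕP.<⇒≤ b<a))))
                    (ℤD.∣⇒∣ᵤ d)

  small-≈⇒≡ : ∀ {a b} → a < n → b < n → + a ≈ + b → a ≡ b
  small-≈⇒≡ {a} {b} a<n b<n e with ℕP.<-cmp a b
  ... | tri< a<b _ _ = ⊥-elim (<-incongruent a<b b<n (≈-sym e))
  ... | tri≈ _ a≡b _ = a≡b
  ... | tri> _ _ b<a = ⊥-elim (<-incongruent b<a a<n e)

  module _ {{_ : NonZero n}} where

    residue : ℤ → ℕ
    residue a = a ℤ.%ℕ n

    residue<n : ∀ a → residue a < n
    residue<n a = ℤDM.n%ℕd<d a n

    ≈residue : ∀ a → a ≈ + residue a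
    ≈residue a = from-≡ (ℤD.divides (a ℤ./ℕ n) refl) (begin
      a ℤ./ℕ n * + n                             ≡⟨ cancel (+ residue a) (a ℤ./ℕ n * + n) ⟨
      + residue a + a ℤ./ℕ n * + n - + residue a ≡⟨ cong (_- + residue a) (ℤDM.a≡a%ℕn+[a/ℕn]*n a n) ⟨
      a - + residue a                            ∎)
      where open ≡-Reasoning
            cancel : ∀ r m → r + m - r ≡ m
            cancel = solve-∀

    residue-injective : ∀ {a b} → residue a ≡ residue b → a ≈ b
    residue-injective {a} {b} eq =
      ≈-trans (≈residue a) (subst (λ r → + r ≈ b) (sym eq) (≈-sym (≈residue b)))

    pigeonhole : (f : Fin (suc n) → ℤ) → ∃ λ i → ∃ λ j → i Fin.< j × f i ≈ f j
    pigeonhole f with FinP.pigeonhole ℕP.≤-refl (λ i → Fin.fromℕ< (residue<n (f i)))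
    ... | i , j , i<j , same = i , j , i<j ,
          residue-injective (FinP.fromℕ<-injective _ _ (residue<n (f i)) (residue<n (f j)) same)

    -- At most n - 1 integers can be pairwise incongruent and nonzero modulo n:
    -- their residues lie in 1, …, n - 1.
    nonzero-bound : ∀ {r} (f : Fin r → ℤ) → (∀ {i j} → f i ≈ f j → i ≡ j) →
                    (∀ i → ¬ f i ≈ 0ℤ) → r ≤ n ℕ.∸ 1
    nonzero-bound {r} f f-inj f≉0 = FinP.injective⇒≤ {f = shifted} shifted-inj
      where
        0<residue : ∀ i → 0 < residue (f i)
        0<residue i = ℕP.n≢0⇒n>0 λ r≡0 → f≉0 i (subst (λ r → f i ≈ + r) r≡0 (≈residue (f i)))
        shifted<n-1 : ∀ i → residue (f i) ℕ.∸ 1 < n ℕ.∸ 1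
        shifted<n-1 i = ℕP.∸-monoˡ-< (residue<n (f i)) (0<residue i)
        shifted : Fin r → Fin (n ℕ.∸ 1)
        shifted i = Fin.fromℕ< (shifted<n-1 i)
        shifted-inj : ∀ {i j} → shifted i ≡ shifted j → i ≡ j
        shifted-inj {i} {j} eq = f-inj (residue-injective (ℕP.∸-cancelʳ-≡ (0<residue i) (0<residue j)
          (FinP.fromℕ<-injective _ _ (shifted<n-1 i) (shifted<n-1 j) eq)))

≈-weaken : ∀ {m n a b} → m ℕD.∣ n → Congruence._≈_ n a b → Congruence._≈_ m a b
≈-weaken {m} (divides q refl) (Congruence.mk d) =
  Congruence.mk (ℤD.∣-trans (ℤD.divides (+ q) (ℤP.pos-* q m)) d)

prime-divisor : ∀ d → 1 < d → ∃ λ l → Prime l × l ℕD.∣ d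
prime-divisor d 1<d = from (factorise d {{ℕ.>-nonZero (ℕP.<-trans ℕ.z<s 1<d)}})
  where
    from : PrimeFactorisation d → ∃ λ l → Prime l × l ℕD.∣ d
    from record { factors = [] ; isFactorisation = d≡1 } = ⊥-elim (ℕP.<⇒≢ 1<d (sym d≡1))
    from record { factors = l ∷ ls ; isFactorisation = d≡ ; factorsPrime = pl ∷ _ } =
      l , pl , subst (l ℕD.∣_) (sym d≡) (ℕD.m∣m*n (product ls))

prime>1 : ∀ {l} → Prime l → 1 < l
prime>1 {l} pl = ℕ.nonTrivial⇒n>1 l {{prime⇒nonTrivial pl}}

prime-coprime : ∀ {l a} → Prime l → ¬ l ℕD.∣ a → Coprime l a
prime-coprime pl l∤a (i∣l , i∣a) with prime⇒irreducible pl i∣l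
... | inj₁ i≡1 = i≡1
... | inj₂ refl = ⊥-elim (l∤a i∣a)

coprime-*ʳ : ∀ {a b c} → Coprime a b → Coprime a c → Coprime a (b ℕ.* c)
coprime-*ʳ {a} {b} {c} ab ac (i∣a , i∣bc) = ac (i∣a , ℕC.coprime-divisor ib i∣bc)
  where ib : Coprime _ b
        ib (j∣i , j∣b) = ab (ℕD.∣-trans j∣i i∣a , j∣b)

coprime-^ʳ : ∀ {a b} k → Coprime a b → Coprime a (b ^ k)
coprime-^ʳ zero    ab (_ , i∣1) = ℕD.∣1⇒≡1 i∣1
coprime-^ʳ (suc k) ab = coprime-*ʳ ab (coprime-^ʳ k ab)

coprime-∣-* : ∀ {r s t} → Coprime r s → r ℕD.∣ t → s ℕD.∣ t → r ℕ.* s ℕD.∣ t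
coprime-∣-* {r} {s} {t} rs (divides a t≡ar) s∣t
  with ℕC.coprime-divisor (ℕC.sym rs) (subst (s ℕD.∣_) (trans t≡ar (ℕP.*-comm a r)) s∣t)
... | divides b a≡bs = divides b (begin
    t             ≡⟨ t≡ar ⟩
    a ℕ.* r       ≡⟨ cong (ℕ._* r) a≡bs ⟩
    b ℕ.* s ℕ.* r ≡⟨ ℕP.*-assoc b s r ⟩
    b ℕ.* (s ℕ.* r) ≡⟨ cong (b ℕ.*_) (ℕP.*-comm s r) ⟩
    b ℕ.* (r ℕ.* s) ∎)
  where open ≡-Reasoning

-- A split of (r , s): coprime divisors u ∣ r and v ∣ s with r < u v.  If s
-- does not divide r such a split exists; it is the key number-theoretic
-- step behind primitive roots.
Split : ℕ → ℕ → Set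
Split r s = ∃ λ u → ∃ λ v → u ℕD.∣ r × v ℕD.∣ s × Coprime u v × r < u ℕ.* v

-- A split of (r₁ , c) lifts to a split of (r₁ l , c l) for a prime l: the
-- factor l joins whichever of u, v it does not divide.
split-lift : ∀ {l r r₁ s c} → Prime l → r ≡ r₁ ℕ.* l → s ≡ c ℕ.* l → Split r₁ c → Split r s
split-lift {l} {r} {r₁} {s} {c} pl r≡r₁l s≡cl (u , v , u∣r₁ , v∣c , uv , r₁<uv) = place (l ℕD.∣? u)
  where
    r<uvl : r < u ℕ.* v ℕ.* l
    r<uvl = subst (_< _) (sym r≡r₁l) (ℕP.*-monoˡ-< l {{prime⇒nonZero pl}} r₁<uv)
    place : Dec (l ℕD.∣ u) → Split r s
    place (no l∤u) = u , v ℕ.* l ,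
      subst (u ℕD.∣_) (sym r≡r₁l) (ℕD.∣m⇒∣m*n l u∣r₁) ,
      subst (v ℕ.* l ℕD.∣_) (sym s≡cl) (ℕD.*-monoˡ-∣ l v∣c) ,
      coprime-*ʳ uv (ℕC.sym (prime-coprime pl l∤u)) ,
      subst (r <_) (ℕP.*-assoc u v l) r<uvl
    place (yes l∣u) = u ℕ.* l , v ,
      subst (u ℕ.* l ℕD.∣_) (sym r≡r₁l) (ℕD.*-monoˡ-∣ l u∣r₁) ,
      ℕD.∣-trans v∣c (divides l (trans s≡cl (ℕP.*-comm c l))) ,
      ℕC.sym (coprime-*ʳ (ℕC.sym uv) (ℕC.sym (prime-coprime pl l∤v))) ,
      subst (r <_) (xy∙z≈xz∙y u v l) r<uvl
      where l∤v : ¬ l ℕD.∣ v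
            l∤v l∣v = ℕP.<⇒≢ (prime>1 pl) (sym (uv (l∣u , l∣v)))

-- By strong induction on s: pick a prime l ∣ s.  If l ∤ r, then (r , l) is
-- a split; otherwise r = r₁ l, s = c l with c ∤ r₁, and a split of
-- (r₁ , c) lifts.
coprime-split : ∀ r s → 0 < r → 0 < s → ¬ s ℕD.∣ r → Split r s
coprime-split r s = <-rec Goal step s r
  where
    Goal : ℕ → Set
    Goal s = ∀ r → 0 < r → 0 < s → ¬ s ℕD.∣ r → Split r s
    step : ∀ s → (∀ {c} → c < s → Goal c) → Goal s
    step (suc zero) _ r _ _ 1∤r = ⊥-elim (1∤r (ℕD.1∣ r))
    step s@(suc (suc _)) ih r 0<r _ s∤r with prime-divisor s (s≤s (s≤s z≤n))
    ... | l , pl , l∣s@(divides c s≡cl) with l ℕD.∣? r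
    ...   | no l∤r = r , l , ℕD.∣-refl , l∣s , ℕC.sym (prime-coprime pl l∤r) ,
                     ℕP.m<m*n r l {{ℕ.>-nonZero 0<r}} (prime>1 pl)
    ...   | yes (divides r₁ r≡r₁l) = split-lift pl r≡r₁l s≡cl (ih c<s r₁ 0<r₁ 0<c c∤r₁)
      where
        0<c : 0 < c
        0<c = ℕP.n≢0⇒n>0 λ { refl → ℕP.0≢1+n (sym s≡cl) }
        0<r₁ : 0 < r₁
        0<r₁ = ℕP.n≢0⇒n>0 λ { refl → ℕP.<⇒≢ 0<r (sym r≡r₁l) }
        c<s : c < s
        c<s = subst (c <_) (sym s≡cl) (ℕP.m<m*n c l {{ℕ.>-nonZero 0<c}} (prime>1 pl))
        c∤r₁ : ¬ c ℕD.∣ r₁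
        c∤r₁ c∣r₁ = s∤r (subst₂ ℕD._∣_ (sym s≡cl) (sym r≡r₁l) (ℕD.*-monoˡ-∣ l c∣r₁))

least : ∀ {P : ℕ → Set} → (∀ t → Dec (P t)) → ∀ t → P t →
        ∃ λ r → P r × (∀ {s} → s < r → ¬ P s)
least {P} P? = <-rec (λ t → P t → ∃ λ r → P r × (∀ {s} → s < r → ¬ P s)) search
  where
    search : ∀ t → (∀ {s} → s < t → P s → ∃ λ r → P r × (∀ {s} → s < r → ¬ P s)) →
             P t → ∃ λ r → P r × (∀ {s} → s < r → ¬ P s)
    search t smaller pt with ℕP.anyUpTo? P? t
    ... | yes (s , s<t , ps) = smaller s<t ps
    ... | no  none           = t , pt , λ s<t ps → none (_ , s<t , ps)

^-distribʳ-* : ∀ x y k → (x * y) ℤ.^ k ≡ x ℤ.^ k * y ℤ.^ k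
^-distribʳ-* x y zero    = refl
^-distribʳ-* x y (suc k) rewrite ^-distribʳ-* x y k = interchange x y (x ℤ.^ k) (y ℤ.^ k)
  where interchange : ∀ x y a b → x * y * (a * b) ≡ x * a * (y * b)
        interchange = solve-∀

-- Monic integer polynomials of degree d, written in Horner form
-- c₀ + x (c₁ + x (⋯ + x · 1)); these are all the polynomials needed to
-- bound the number of roots of x^r - 1 modulo a prime.
infixr 5 _∷ₘ_
data Monic : ℕ → Set where
  one  : Monic 0
  _∷ₘ_ : ∀ {d} → ℤ → Monic d → Monic (suc d)

eval : ∀ {d} → Monic d → ℤ → ℤ
eval one      x = 1ℤ
eval (c ∷ₘ f) x = c + x * eval f x

-- Division by x - a: f(x) - f(a) = (x - a) · (f ÷ a)(x), the quotient being
-- monic of one degree less.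
_÷_ : ∀ {d} → Monic (suc d) → ℤ → Monic d
(c ∷ₘ one)      ÷ a = one
(c ∷ₘ (c′ ∷ₘ f)) ÷ a = eval (c′ ∷ₘ f) a ∷ₘ ((c′ ∷ₘ f) ÷ a)

factor-theorem : ∀ {d} (f : Monic (suc d)) x a → eval f x - eval f a ≡ (x - a) * eval (f ÷ a) x
factor-theorem (c ∷ₘ one) x a = linear c x a
  where linear : ∀ c x a → c + x * 1ℤ - (c + a * 1ℤ) ≡ (x - a) * 1ℤ
        linear = solve-∀
factor-theorem (c ∷ₘ f@(c′ ∷ₘ _)) x a = begin
    c + x * eval f x - (c + a * eval f a)               ≡⟨ split c x a (eval f x) (eval f a) ⟩
    x * (eval f x - eval f a) + (x - a) * eval f a      ≡⟨ cong (λ e → x * e + (x - a) * eval f a) (factor-theorem f x a) ⟩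
    x * ((x - a) * eval (f ÷ a) x) + (x - a) * eval f a ≡⟨ collect x a (eval (f ÷ a) x) (eval f a) ⟩
    (x - a) * (eval f a + x * eval (f ÷ a) x)           ∎
  where
    open ≡-Reasoning
    split : ∀ c x a u v → c + x * u - (c + a * v) ≡ x * (u - v) + (x - a) * v
    split = solve-∀
    collect : ∀ x a q v → x * ((x - a) * q) + (x - a) * v ≡ (x - a) * (v + x * q)
    collect = solve-∀

monomial : ∀ k → Monic k
monomial zero    = one
monomial (suc k) = 0ℤ ∷ₘ monomial k

eval-monomial : ∀ k x → eval (monomial k) x ≡ x ℤ.^ k
eval-monomial zero    x = refl
eval-monomial (suc k) x = trans (ℤP.+-identityˡ _) (cong (x *_) (eval-monomial k x))

pow-minus-one : ∀ k → Monic (suc k)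
pow-minus-one k = - 1ℤ ∷ₘ monomial k

eval-pow-minus-one : ∀ k x → eval (pow-minus-one k) x ≡ x ℤ.^ suc k - 1ℤ
eval-pow-minus-one k x =
  trans (ℤP.+-comm (- 1ℤ) (x * eval (monomial k) x)) (cong (λ e → x * e - 1ℤ) (eval-monomial k x))

module ModPrime (p : ℕ) (pr : Prime p) where
  open Congruence p public

  instance
    p≢0 : NonZero p
    p≢0 = prime⇒nonZero pr

  p-1<p : p ℕ.∸ 1 < p
  p-1<p = ℕP.∸-monoʳ-< {o = 0} ℕ.z<s (ℕ.>-nonZero⁻¹ p)

  Unit : ℤ → Set
  Unit a = ¬ a ≈ 0ℤ

  euclid : ∀ {a b} → a * b ≈ 0ℤ → a ≈ 0ℤ ⊎ b ≈ 0ℤ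
  euclid {a} {b} ab≈0
    with euclidsLemma ∣ a ∣ ∣ b ∣ pr (subst (p ℕD.∣_) (ℤP.abs-* a b) (ℤD.∣⇒∣ᵤ (≈0⇒∣ ab≈0)))
  ... | inj₁ p∣a = inj₁ (∣⇒≈0 (ℤD.∣ᵤ⇒∣ p∣a))
  ... | inj₂ p∣b = inj₂ (∣⇒≈0 (ℤD.∣ᵤ⇒∣ p∣b))

  unit-* : ∀ {a b} → Unit a → Unit b → Unit (a * b)
  unit-* ua ub ab≈0 with euclid ab≈0
  ... | inj₁ a≈0 = ua a≈0
  ... | inj₂ b≈0 = ub b≈0

  unit-1 : Unit 1ℤ
  unit-1 1≈0 = ℕP.<⇒≢ (prime>1 pr) (sym (ℕD.∣1⇒≡1 (ℤD.∣⇒∣ᵤ (≈0⇒∣ 1≈0))))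

  unit-^ : ∀ {a} k → Unit a → Unit (a ℤ.^ k)
  unit-^ zero    ua = unit-1
  unit-^ (suc k) ua = unit-* ua (unit-^ k ua)

  unit-cong : ∀ {a b} → a ≈ b → Unit a → Unit b
  unit-cong a≈b ua b≈0 = ua (≈-trans a≈b b≈0)

  cancelˡ : ∀ {u a b} → Unit u → u * a ≈ u * b → a ≈ b
  cancelˡ {u} {a} {b} uu ua≈ub with euclid (subst (_≈ 0ℤ) (factor u a b) (≈⇒-≈0 ua≈ub))
    where factor : ∀ u a b → u * a - u * b ≡ u * (a - b)
          factor = solve-∀
  ... | inj₁ u≈0   = ⊥-elim (uu u≈0)
  ... | inj₂ a-b≈0 = -≈0⇒≈ a-b≈0

  unit⇒coprime : ∀ {a} k → Unit a → CoprimeTo (p ^ k) a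
  unit⇒coprime k ua = coprime-^ʳ k (ℕC.sym (prime-coprime pr λ p∣a → ua (∣⇒≈0 (ℤD.∣ᵤ⇒∣ p∣a))))

  pow1-* : ∀ {x} a b → x ℤ.^ a ≈ 1ℤ → x ℤ.^ (a ℕ.* b) ≈ 1ℤ
  pow1-* {x} a b xᵃ≈1 =
    subst₂ _≈_ (ℤP.^-*-assoc x a b) (ℤP.^-zeroˡ b) (^-cong b xᵃ≈1)

  pow-cancel : ∀ {x} i j → Unit x → x ℤ.^ i ≈ x ℤ.^ (i ℕ.+ j) → x ℤ.^ j ≈ 1ℤ
  pow-cancel {x} i j ux xⁱ≈xⁱ⁺ʲ = ≈-sym (cancelˡ (unit-^ i ux)
    (subst₂ _≈_ (sym (ℤP.*-identityʳ (x ℤ.^ i))) (ℤP.^-distribˡ-+-* x i j) xⁱ≈xⁱ⁺ʲ))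

  pow-cancel< : ∀ {x i j} → Unit x → i < j → x ℤ.^ i ≈ x ℤ.^ j → x ℤ.^ (j ℕ.∸ i) ≈ 1ℤ
  pow-cancel< {x} {i} {j} ux i<j xⁱ≈xʲ =
    pow-cancel i (j ℕ.∸ i) ux (subst (λ e → x ℤ.^ i ≈ x ℤ.^ e) (sym (ℕP.m+[n∸m]≡n (ℕP.<⇒≤ i<j))) xⁱ≈xʲ)

  record IsOrder (x : ℤ) (r : ℕ) : Set where
    field
      positive          : 0 < r
      pow≈1             : x ℤ.^ r ≈ 1ℤ
      divides-exponents : ∀ t → x ℤ.^ t ≈ 1ℤ → r ℕD.∣ t
  open IsOrder public

  least⇒order : ∀ {x r} → 0 < r → x ℤ.^ r ≈ 1ℤ →
                (∀ {s} → s < r → ¬ (0 < s × x ℤ.^ s ≈ 1ℤ)) → IsOrder x r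
  least⇒order {x} {r} 0<r xʳ≈1 below = record { positive = 0<r ; pow≈1 = xʳ≈1 ; divides-exponents = r∣ }
    where
      instance
        r≢0 : NonZero r
        r≢0 = ℕ.>-nonZero 0<r
      r∣ : ∀ t → x ℤ.^ t ≈ 1ℤ → r ℕD.∣ t
      r∣ t xᵗ≈1 with t ℕ.% r ℕ.≟ 0
      ... | yes t%r≡0 = ℕD.m%n≡0⇒n∣m t r t%r≡0
      ... | no  t%r≢0 = ⊥-elim (below (ℕDM.m%n<n t r) (ℕP.n≢0⇒n>0 t%r≢0 , remainder≈1))
        where
          open Relation.Binary.Reasoning.Setoid ≈-setoid
          remainder≈1 : x ℤ.^ (t ℕ.% r) ≈ 1ℤ
          remainder≈1 = begin
            x ℤ.^ (t ℕ.% r)                               ≡⟨ ℤP.*-identityˡ _ ⟨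
            1ℤ * x ℤ.^ (t ℕ.% r)                          ≈⟨ *-cong (pow1-* r (t ℕ./ r) xʳ≈1) ≈-refl ⟨
            x ℤ.^ (r ℕ.* (t ℕ./ r)) * x ℤ.^ (t ℕ.% r)     ≡⟨ ℤP.^-distribˡ-+-* x (r ℕ.* (t ℕ./ r)) (t ℕ.% r) ⟨
            x ℤ.^ (r ℕ.* (t ℕ./ r) ℕ.+ t ℕ.% r)           ≡⟨ cong (x ℤ.^_) division ⟩
            x ℤ.^ t                                       ≈⟨ xᵗ≈1 ⟩
            1ℤ                                            ∎
            where division : r ℕ.* (t ℕ./ r) ℕ.+ t ℕ.% r ≡ t
                  division = trans (ℕP.+-comm _ (t ℕ.% r))
                    (trans (cong (t ℕ.% r ℕ.+_) (ℕP.*-comm r (t ℕ./ r))) (sym (ℕDM.m≡m%n+[m/n]*n t r)))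

  -- Every unit has an order: by pigeonhole some x^i ≈ x^j with i < j ≤ p,
  -- so a positive power of x is 1, and we take the least one.
  order-exists : ∀ {x} → Unit x → ∃ (IsOrder x)
  order-exists {x} ux = from-pigeonhole (pigeonhole (λ i → x ℤ.^ Fin.toℕ i))
    where
      returns-1? : ∀ t → Dec (0 < t × x ℤ.^ t ≈ 1ℤ)
      returns-1? t = 0 ℕ.<? t ×-dec (x ℤ.^ t ≈? 1ℤ)
      from-least : (∃ λ r → (0 < r × x ℤ.^ r ≈ 1ℤ) × (∀ {s} → s < r → ¬ (0 < s × x ℤ.^ s ≈ 1ℤ))) → ∃ (IsOrder x)
      from-least (r , (0<r , xʳ≈1) , below) = r , least⇒order 0<r xʳ≈1 below
      from-pigeonhole : (∃ λ i → ∃ λ j → i Fin.< j × x ℤ.^ Fin.toℕ i ≈ x ℤ.^ Fin.toℕ j) → ∃ (IsOrder x)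
      from-pigeonhole (i , j , i<j , xⁱ≈xʲ) =
        from-least (least returns-1? _ (ℕP.m<n⇒0<n∸m i<j , pow-cancel< ux i<j xⁱ≈xʲ))

  order-gap : ∀ {x r i j} → IsOrder x r → Unit x → i < j → j < r → ¬ x ℤ.^ i ≈ x ℤ.^ j
  order-gap {i = i} {j} ord ux i<j j<r xⁱ≈xʲ = ℕP.<⇒≱ (ℕP.≤-<-trans (ℕP.m∸n≤m j i) j<r)
    (ℕD.∣⇒≤ {{ℕ.>-nonZero (ℕP.m<n⇒0<n∸m i<j)}} (divides-exponents ord _ (pow-cancel< ux i<j xⁱ≈xʲ)))

  pow-injective : ∀ {x r i j} → IsOrder x r → Unit x → i < r → j < r →
                  x ℤ.^ i ≈ x ℤ.^ j → i ≡ j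
  pow-injective {i = i} {j} ord ux i<r j<r xⁱ≈xʲ with ℕP.<-cmp i j
  ... | tri< i<j _ _ = ⊥-elim (order-gap ord ux i<j j<r xⁱ≈xʲ)
  ... | tri≈ _ i≡j _ = i≡j
  ... | tri> _ _ j<i = ⊥-elim (order-gap ord ux j<i i<r (≈-sym xⁱ≈xʲ))

  -- The powers below the order are incongruent units, so r ≤ p - 1.
  order≤p-1 : ∀ {x r} → IsOrder x r → Unit x → r ≤ p ℕ.∸ 1
  order≤p-1 {x} ord ux = nonzero-bound (λ i → x ℤ.^ Fin.toℕ i)
    (λ e → FinP.toℕ-injective (pow-injective ord ux (FinP.toℕ<n _) (FinP.toℕ<n _) e))
    (λ i → unit-^ (Fin.toℕ i) ux)

  pow1-of-multiple : ∀ {x r m} → IsOrder x r → r ℕD.∣ m → x ℤ.^ m ≈ 1ℤ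
  pow1-of-multiple {x} {r} ord (divides c refl) =
    subst (λ e → x ℤ.^ e ≈ 1ℤ) (ℕP.*-comm r c) (pow1-* r c (pow≈1 ord))

  order-pow : ∀ {x r} w u → IsOrder x r → r ≡ w ℕ.* u → IsOrder (x ℤ.^ w) u
  order-pow {x} w u ord refl = record
    { positive          = ℕ.>-nonZero⁻¹ u
    ; pow≈1             = subst (_≈ 1ℤ) (sym (ℤP.^-*-assoc x w u)) (pow≈1 ord)
    ; divides-exponents = λ t xʷᵗ≈1 → ℕD.*-cancelˡ-∣ w
        (divides-exponents ord (w ℕ.* t) (subst (_≈ 1ℤ) (ℤP.^-*-assoc x w t) xʷᵗ≈1))
    }
    where
      instance
        wu≢0 : NonZero (w ℕ.* u)
        wu≢0 = ℕ.>-nonZero (positive ord)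
        w≢0 : NonZero w
        w≢0 = ℕP.m*n≢0⇒m≢0 w
        u≢0 : NonZero u
        u≢0 = ℕP.m*n≢0⇒n≢0 w

  pow1-factor : ∀ {x y} m → y ℤ.^ m ≈ 1ℤ → (x * y) ℤ.^ m ≈ 1ℤ → x ℤ.^ m ≈ 1ℤ
  pow1-factor {x} {y} m yᵐ≈1 xyᵐ≈1 = begin
      x ℤ.^ m                  ≡⟨ ℤP.*-identityʳ _ ⟨
      x ℤ.^ m * 1ℤ             ≈⟨ *-cong (≈-refl {x ℤ.^ m}) yᵐ≈1 ⟨
      x ℤ.^ m * y ℤ.^ m        ≡⟨ ^-distribʳ-* x y m ⟨
      (x * y) ℤ.^ m            ≈⟨ xyᵐ≈1 ⟩
      1ℤ                       ∎
    where open Relation.Binary.Reasoning.Setoid ≈-setoid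

  order-divides-product : ∀ {x y r s t} → IsOrder x r → IsOrder y s → Coprime r s →
                          (x * y) ℤ.^ t ≈ 1ℤ → r ℕD.∣ t
  order-divides-product {x} {y} {r} {s} {t} ox oy rs xyᵗ≈1 = ℕC.coprime-divisor rs
    (divides-exponents ox (s ℕ.* t) (pow1-factor (s ℕ.* t) (pow1-of-multiple oy (ℕD.m∣m*n t))
      (subst (λ e → (x * y) ℤ.^ e ≈ 1ℤ) (ℕP.*-comm t s) (pow1-* t s xyᵗ≈1))))

  order-* : ∀ {x y r s} → IsOrder x r → IsOrder y s → Coprime r s → IsOrder (x * y) (r ℕ.* s)
  order-* {x} {y} {r} {s} ox oy rs = record
    { positive          = ℕ.>-nonZero⁻¹ (r ℕ.* s)
        {{ℕP.m*n≢0 r s {{ℕ.>-nonZero (positive ox)}} {{ℕ.>-nonZero (positive oy)}}}}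
    ; pow≈1             = pow1-of-product
    ; divides-exponents = λ t xyᵗ≈1 → coprime-∣-* rs
        (order-divides-product ox oy rs xyᵗ≈1)
        (order-divides-product oy ox (ℕC.sym rs) (subst (λ z → z ℤ.^ t ≈ 1ℤ) (ℤP.*-comm x y) xyᵗ≈1))
    }
    where
      pow1-of-product : (x * y) ℤ.^ (r ℕ.* s) ≈ 1ℤ
      pow1-of-product = subst₂ _≈_ (sym (^-distribʳ-* x y (r ℕ.* s))) (ℤP.*-identityʳ 1ℤ)
        (*-cong (pow1-of-multiple ox (ℕD.m∣m*n s)) (pow1-of-multiple oy (ℕD.n∣m*n r)))

  -- If some unit y has y^r ≉ 1, where r is the order of the unit g, then
  -- some unit has larger order: split r and the order s of y (s ∤ r) into
  -- coprime u ∣ r, v ∣ s with r < u v, and combine g^(r/u) and y^(s/v).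
  LargerOrder : ℕ → Set
  LargerOrder r = ∃ λ g′ → ∃ λ r′ → Unit g′ × IsOrder g′ r′ × r < r′

  larger-order : ∀ {g r y} → Unit g → IsOrder g r → Unit y → ¬ y ℤ.^ r ≈ 1ℤ → LargerOrder r
  larger-order {g} {r} {y} ug og uy yʳ≉1 = from-order (order-exists uy)
    where
      from-split : ∀ {s} → IsOrder y s → Split r s → LargerOrder r
      from-split oy (u , v , divides w r≡wu , divides w′ s≡w′v , uv , r<uv) =
        g ℤ.^ w * y ℤ.^ w′ , u ℕ.* v , unit-* (unit-^ w ug) (unit-^ w′ uy) ,
        order-* (order-pow w u og r≡wu) (order-pow w′ v oy s≡w′v) uv , r<uv
      from-order : ∃ (IsOrder y) → LargerOrder r
      from-order (s , oy) = from-split oy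
        (coprime-split r s (positive og) (positive oy) (λ s∣r → yʳ≉1 (pow1-of-multiple oy s∣r)))

  -- A monic polynomial of degree d has at most d pairwise incongruent roots:
  -- by the factor theorem, the other roots are roots of f ÷ a for a root a.
  roots-bound : ∀ {d m} (f : Monic d) (ys : Fin m → ℤ) → (∀ {i j} → ys i ≈ ys j → i ≡ j) →
                (∀ i → eval f (ys i) ≈ 0ℤ) → m ≤ d
  roots-bound {m = zero}  f        ys _      _     = z≤n
  roots-bound {m = suc m} one      ys _      roots = ⊥-elim (unit-1 (roots Fin.zero))
  roots-bound {m = suc m} (c ∷ₘ f) ys ys-inj roots =
    s≤s (roots-bound ((c ∷ₘ f) ÷ a) (λ i → ys (Fin.suc i)) (λ e → FinP.suc-injective (ys-inj e)) quotient-roots)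
    where
      a : ℤ
      a = ys Fin.zero
      quotient-roots : ∀ i → eval ((c ∷ₘ f) ÷ a) (ys (Fin.suc i)) ≈ 0ℤ
      quotient-roots i = root-of-quotient (euclid (subst (_≈ 0ℤ) (factor-theorem (c ∷ₘ f) y a) f[y]-f[a]≈0))
        where
          y = ys (Fin.suc i)
          f[y]-f[a]≈0 : eval (c ∷ₘ f) y - eval (c ∷ₘ f) a ≈ 0ℤ
          f[y]-f[a]≈0 = subst (eval (c ∷ₘ f) y - eval (c ∷ₘ f) a ≈_) (ℤP.+-inverseʳ 0ℤ)
                          (-‿cong (roots (Fin.suc i)) (roots Fin.zero))
          root-of-quotient : y - a ≈ 0ℤ ⊎ eval ((c ∷ₘ f) ÷ a) y ≈ 0ℤ → eval ((c ∷ₘ f) ÷ a) y ≈ 0ℤ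
          root-of-quotient (inj₁ y-a≈0) = ⊥-elim (FinP.0≢1+n (sym (ys-inj (-≈0⇒≈ y-a≈0))))
          root-of-quotient (inj₂ q≈0)   = q≈0

  nonzero-residue : Fin (p ℕ.∸ 1) → ℤ
  nonzero-residue i = + suc (Fin.toℕ i)

  nonzero-residue<p : ∀ i → suc (Fin.toℕ i) < p
  nonzero-residue<p i = ℕP.≤-<-trans (FinP.toℕ<n i) p-1<p

  nonzero-residue-injective : ∀ {i j} → nonzero-residue i ≈ nonzero-residue j → i ≡ j
  nonzero-residue-injective e =
    FinP.toℕ-injective (ℕP.suc-injective (small-≈⇒≡ (nonzero-residue<p _) (nonzero-residue<p _) e))

  nonzero-residue-unit : ∀ i → Unit (nonzero-residue i)
  nonzero-residue-unit i e = ℕP.0≢1+n (sym (small-≈⇒≡ (nonzero-residue<p i) (ℕ.>-nonZero⁻¹ p) e))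

  -- If r > 0 and y^r ≈ 1 for each of 1, …, p - 1, then p - 1 ≤ r: these are
  -- p - 1 incongruent roots of the degree r polynomial x^r - 1.
  exponent-bound : ∀ {r} → 0 < r → (∀ i → nonzero-residue i ℤ.^ r ≈ 1ℤ) → p ℕ.∸ 1 ≤ r
  exponent-bound {suc k} _ all-roots =
    roots-bound (pow-minus-one k) nonzero-residue nonzero-residue-injective root
    where root : ∀ i → eval (pow-minus-one k) (nonzero-residue i) ≈ 0ℤ
          root i = subst₂ _≈_ (sym (eval-pow-minus-one k (nonzero-residue i))) (ℤP.+-inverseʳ 1ℤ)
                     (-‿cong (all-roots i) (≈-refl {1ℤ}))

  -- A primitive root modulo p exists: starting from 1, enlarge the order r
  -- of a unit (larger-order) as long as some nonzero residue is not a root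
  -- of x^r - 1.  Orders never exceed p - 1, which bounds the number of
  -- steps, and when every residue is a root the order is p - 1.
  PrimitiveRoot : Set
  PrimitiveRoot = ∃ λ g → Unit g × IsOrder g (p ℕ.∸ 1)

  primitive-root : PrimitiveRoot
  primitive-root = climb p unit-1 order-of-1 (ℕP.≤-<-trans (ℕP.m∸n≤m (p ℕ.∸ 1) 1) p-1<p)
    where
      order-of-1 : IsOrder 1ℤ 1
      order-of-1 = record { positive = ℕ.z<s ; pow≈1 = ≈-refl ; divides-exponents = λ t _ → ℕD.1∣ t }
      climb : ∀ steps {g r} → Unit g → IsOrder g r → (p ℕ.∸ 1) ℕ.∸ r < steps → PrimitiveRoot
      climb (suc steps) {g} {r} ug og bound = decide (FinP.all? root?)
        where
          root? : ∀ i → Dec (nonzero-residue i ℤ.^ r ≈ 1ℤ)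
          root? i = nonzero-residue i ℤ.^ r ≈? 1ℤ
          continue : LargerOrder r → PrimitiveRoot
          continue (g′ , r′ , ug′ , og′ , r<r′) =
            climb steps ug′ og′ (ℕP.<-≤-trans (ℕP.∸-monoʳ-< r<r′ (order≤p-1 og′ ug′)) (ℕ.s≤s⁻¹ bound))
          non-root : (∃ λ i → ¬ nonzero-residue i ℤ.^ r ≈ 1ℤ) → PrimitiveRoot
          non-root (i , yʳ≉1) = continue (larger-order ug og (nonzero-residue-unit i) yʳ≉1)
          decide : Dec (∀ i → nonzero-residue i ℤ.^ r ≈ 1ℤ) → PrimitiveRoot
          decide (yes all-roots) =
            g , ug , subst (IsOrder g) (ℕP.≤-antisym (order≤p-1 og ug) (exponent-bound (positive og) all-roots)) og
          decide (no ¬all-roots) = non-root (FinP.¬∀⟶∃¬ _ _ root? ¬all-roots)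

-- Euler's totient at a prime power: counting 1, …, M, the integers
-- coprime to p^(k+1) are exactly those not divisible by p, so each block
-- of p consecutive integers contributes p - 1, and φ(p^(k+1)) = p^k (p - 1).
module PrimePowerTotient (p k : ℕ) (pr : Prime p) where

  instance
    p≢0 : NonZero p
    p≢0 = prime⇒nonZero pr

  N : ℕ
  N = p ^ suc k

  coprime? : ∀ x → Dec (gcd x N ≡ 1)
  coprime? x = gcd x N ℕ.≟ 1

  count : ℕ → ℕ
  count M = length (filter coprime? (map suc (upTo M)))

  not-multiple⇒coprime : ∀ {x} → ¬ p ℕD.∣ x → gcd x N ≡ 1
  not-multiple⇒coprime p∤x = ℕC.coprime⇒gcd≡1 (coprime-^ʳ (suc k) (ℕC.sym (prime-coprime pr p∤x)))

  multiple⇒not-coprime : ∀ {x} → p ℕD.∣ x → gcd x N ≢ 1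
  multiple⇒not-coprime p∣x gcd≡1 = ℕP.<⇒≢ (prime>1 pr)
    (sym (ℕD.∣1⇒≡1 (subst (p ℕD.∣_) gcd≡1 (gcd-greatest p∣x (ℕD.m∣m*n (p ^ k))))))

  count-suc : ∀ M → count (suc M) ≡ count M ℕ.+ length (filter coprime? [ suc M ])
  count-suc M = begin
    length (filter coprime? (map suc (upTo (suc M))))                 ≡⟨ cong (λ xs → length (filter coprime? (map suc xs))) (LP.upTo-∷ʳ M) ⟨
    length (filter coprime? (map suc (upTo M ++ [ M ])))              ≡⟨ cong (λ xs → length (filter coprime? xs)) (LP.map-++ suc (upTo M) [ M ]) ⟩
    length (filter coprime? (map suc (upTo M) ++ [ suc M ]))          ≡⟨ cong length (LP.filter-++ coprime? (map suc (upTo M)) [ suc M ]) ⟩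
    length (filter coprime? (map suc (upTo M)) ++ filter coprime? [ suc M ]) ≡⟨ LP.length-++ (filter coprime? (map suc (upTo M))) ⟩
    count M ℕ.+ length (filter coprime? [ suc M ])                     ∎
    where open ≡-Reasoning

  count-not-multiple : ∀ M → ¬ p ℕD.∣ suc M → count (suc M) ≡ suc (count M)
  count-not-multiple M p∤ = trans (count-suc M)
    (trans (cong (λ xs → count M ℕ.+ length xs) (LP.filter-accept coprime? {x = suc M} {xs = []} (not-multiple⇒coprime p∤)))
           (ℕP.+-comm (count M) 1))

  count-multiple : ∀ M → p ℕD.∣ suc M → count (suc M) ≡ count M
  count-multiple M p∣ = trans (count-suc M)
    (trans (cong (λ xs → count M ℕ.+ length xs) (LP.filter-reject coprime? {x = suc M} {xs = []} (multiple⇒not-coprime p∣)))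
           (ℕP.+-identityʳ (count M)))

  count-blocks : ∀ t r → r < p → count (t ℕ.* p ℕ.+ r) ≡ t ℕ.* (p ℕ.∸ 1) ℕ.+ r
  count-blocks zero    zero    _ = refl
  count-blocks t       (suc r) r<p = begin
    count (t ℕ.* p ℕ.+ suc r)          ≡⟨ cong count (ℕP.+-suc (t ℕ.* p) r) ⟩
    count (suc (t ℕ.* p ℕ.+ r))        ≡⟨ count-not-multiple _ p∤ ⟩
    suc (count (t ℕ.* p ℕ.+ r))        ≡⟨ cong suc (count-blocks t r (ℕP.<-trans (ℕP.n<1+n r) r<p)) ⟩
    suc (t ℕ.* (p ℕ.∸ 1) ℕ.+ r)        ≡⟨ ℕP.+-suc (t ℕ.* (p ℕ.∸ 1)) r ⟨
    t ℕ.* (p ℕ.∸ 1) ℕ.+ suc r          ∎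
    where
      open ≡-Reasoning
      p∤ : ¬ p ℕD.∣ suc (t ℕ.* p ℕ.+ r)
      p∤ p∣ = ℕP.<⇒≱ r<p (ℕD.∣⇒≤ (ℕD.∣m+n∣m⇒∣n
                (subst (p ℕD.∣_) (sym (ℕP.+-suc (t ℕ.* p) r)) p∣)
                (ℕD.n∣m*n t)))
  count-blocks (suc t) zero    _ = begin
    count (suc t ℕ.* p ℕ.+ 0)          ≡⟨ cong count last ⟩
    count (suc (t ℕ.* p ℕ.+ (p ℕ.∸ 1))) ≡⟨ count-multiple _ (subst (p ℕD.∣_) last (divides (suc t) (ℕP.+-identityʳ (suc t ℕ.* p)))) ⟩
    count (t ℕ.* p ℕ.+ (p ℕ.∸ 1))       ≡⟨ count-blocks t (p ℕ.∸ 1) (ModPrime.p-1<p p pr) ⟩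
    t ℕ.* (p ℕ.∸ 1) ℕ.+ (p ℕ.∸ 1)       ≡⟨ ℕP.+-comm (t ℕ.* (p ℕ.∸ 1)) (p ℕ.∸ 1) ⟩
    suc t ℕ.* (p ℕ.∸ 1)                 ≡⟨ ℕP.+-identityʳ _ ⟨
    suc t ℕ.* (p ℕ.∸ 1) ℕ.+ 0           ∎
    where
      open ≡-Reasoning
      last : suc t ℕ.* p ℕ.+ 0 ≡ suc (t ℕ.* p ℕ.+ (p ℕ.∸ 1))
      last = trans (ℕP.+-identityʳ _) (trans (ℕP.+-comm p (t ℕ.* p))
               (trans (cong (t ℕ.* p ℕ.+_) (sym (ℕP.m+[n∸m]≡n (ℕ.>-nonZero⁻¹ p)))) (ℕP.+-suc (t ℕ.* p) (p ℕ.∸ 1))))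

  φ-prime-power : φ (p ^ suc k) ≡ p ^ k ℕ.* (p ℕ.∸ 1)
  φ-prime-power = begin
    count N                               ≡⟨ cong count (trans (ℕP.*-comm p (p ^ k)) (sym (ℕP.+-identityʳ _))) ⟩
    count (p ^ k ℕ.* p ℕ.+ 0)             ≡⟨ count-blocks (p ^ k) 0 (ℕ.>-nonZero⁻¹ p) ⟩
    p ^ k ℕ.* (p ℕ.∸ 1) ℕ.+ 0             ≡⟨ ℕP.+-identityʳ _ ⟩
    p ^ k ℕ.* (p ℕ.∸ 1)                   ∎
    where open ≡-Reasoning

cancel-scaled : ∀ {p q a b} c → NonZero p → Coprime ∣ c ∣ q → a < q → b < q →
                Congruence._≈_ (p ℕ.* q) (+ p * (c * (+ a - + b))) 0ℤ → a ≡ b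
cancel-scaled {p} {q} {a} {b} c p≢0 cq a<q b<q pc[a-b]≈0 =
  Congruence.small-≈⇒≡ q a<q b<q (Congruence.mk (ℤD.∣ᵤ⇒∣ q∣a-b))
  where
    pq∣ : p ℕ.* q ℕD.∣ p ℕ.* (∣ c ∣ ℕ.* ∣ + a - + b ∣)
    pq∣ = subst (p ℕ.* q ℕD.∣_) (trans (ℤP.abs-* (+ p) _) (cong (p ℕ.*_) (ℤP.abs-* c _)))
            (ℤD.∣⇒∣ᵤ (Congruence.≈0⇒∣ (p ℕ.* q) pc[a-b]≈0))
    q∣a-b : q ℕD.∣ ∣ + a - + b ∣
    q∣a-b = ℕC.coprime-divisor (ℕC.sym cq) (ℕD.*-cancelˡ-∣ p {{p≢0}} pq∣)

cyc-suc-cases : ∀ {m} (x : Fin m) →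
  (suc (Fin.toℕ x) < m × Fin.toℕ (cyc-suc x) ≡ suc (Fin.toℕ x)) ⊎
  (suc (Fin.toℕ x) ≡ m × Fin.toℕ (cyc-suc x) ≡ 0)
cyc-suc-cases {suc m} x with Fin.toℕ x ℕ.<? m
... | yes x<m = inj₁ (s≤s x<m , FinP.toℕ-fromℕ< (s≤s x<m))
... | no  x≮m = inj₂ (ℕP.≤-antisym (FinP.toℕ<n x) (ℕP.≰⇒> x≮m) , refl)

-- The construction, for n = p^(k+1) = p q with p an odd prime and g a
-- primitive root modulo p.  Positions 0 ≤ j < q (p - 1) are written
-- j = i + s (p - 1) with i < p - 1 and s < q, and position (i , s) carries
--   value (i , s) = g^i + p (i + 1) s.
module Construction (p k : ℕ) (pr : Prime p) (p≢2 : p ≢ 2) where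
  open ModPrime p pr

  q n P₁ : ℕ
  q  = p ^ k
  n  = p ^ suc k
  P₁ = p ℕ.∸ 1

  module Modₙ = Congruence n
  open Modₙ using () renaming (_≈_ to _≈ₙ_)

  -- p ≥ 3 as p ≠ 2, so p - 1 > 1.
  1<P₁ : 1 < P₁
  1<P₁ = ℕP.∸-monoˡ-≤ 1 (ℕP.≤∧≢⇒< (prime>1 pr) (λ 2≡p → p≢2 (sym 2≡p)))

  instance
    P₁≢0 : NonZero P₁
    P₁≢0 = ℕ.>-nonZero (ℕP.<-trans ℕ.z<s 1<P₁)

  g : ℤ
  g = proj₁ primitive-root

  unit-g : Unit g
  unit-g = proj₁ (proj₂ primitive-root)

  order-g : IsOrder g P₁
  order-g = proj₂ (proj₂ primitive-root)

  Coord : Set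
  Coord = ℕ × ℕ

  coords : ℕ → Coord
  coords j = j ℕ.% P₁ , j ℕ./ P₁

  next : Coord → Coord
  next (i , s) with suc i ℕ.<? P₁
  ... | yes _ = suc i , s
  ... | no  _ = 0 , suc s

  next-cases : ∀ {i} → i < P₁ →
    (suc i < P₁ × (∀ s → next (i , s) ≡ (suc i , s))) ⊎ (suc i ≡ P₁ × (∀ s → next (i , s) ≡ (0 , suc s)))
  next-cases {i} i<P₁ with suc i ℕ.<? P₁
  ... | yes i+1<P₁ = inj₁ (i+1<P₁ , λ _ → refl)
  ... | no  i+1≮P₁ = inj₂ (ℕP.≤-antisym i<P₁ (ℕ.s≤s⁻¹ (ℕP.≰⇒> i+1≮P₁)) , λ _ → refl)

  coords-unique : ∀ {i s} → i < P₁ → coords (i ℕ.+ s ℕ.* P₁) ≡ (i , s)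
  coords-unique {i} {s} i<P₁ = cong₂ _,_ remainder quotient
    where
      j = i ℕ.+ s ℕ.* P₁
      remainder : j ℕ.% P₁ ≡ i
      remainder = trans (ℕDM.[m+kn]%n≡m%n i s P₁) (ℕDM.m<n⇒m%n≡m i<P₁)
      quotient : j ℕ./ P₁ ≡ s
      quotient = ℕP.*-cancelʳ-≡ _ s P₁ (ℕP.+-cancelˡ-≡ i _ _
        (trans (cong (ℕ._+ (j ℕ./ P₁) ℕ.* P₁) (sym remainder)) (sym (ℕDM.m≡m%n+[m/n]*n j P₁))))

  coords-suc : ∀ j → coords (suc j) ≡ next (coords j)
  coords-suc j with next-cases (ℕDM.m%n<n j P₁)
  ... | inj₁ (i+1<P₁ , step) = trans (cong coords (cong suc (ℕDM.m≡m%n+[m/n]*n j P₁)))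
                                 (trans (coords-unique i+1<P₁) (sym (step (j ℕ./ P₁))))
  ... | inj₂ (i+1≡P₁ , wrap) = trans (cong coords (trans (cong suc (ℕDM.m≡m%n+[m/n]*n j P₁))
                                                         (cong (ℕ._+ (j ℕ./ P₁) ℕ.* P₁) i+1≡P₁)))
                                 (trans (coords-unique (ℕ.>-nonZero⁻¹ P₁)) (sym (wrap (j ℕ./ P₁))))

  value : Coord → ℤ
  value (i , s) = g ℤ.^ i + + p * (+ suc i * + s)

  difference : Coord → ℤ
  difference c = value c - value (next c)

  p*≈0 : ∀ x → + p * x ≈ 0ℤ
  p*≈0 x = subst (_≈ 0ℤ) (ℤP.*-comm x (+ p)) (*n≈0 x)

  -- Modulo p, value (i , s) ≈ g^i and the next value is ≈ g^(i+1), because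
  -- g^(p-1) ≈ 1; hence every difference is ≈ g^i (1 - g).
  value≈ : ∀ i s → value (i , s) ≈ g ℤ.^ i
  value≈ i s = ≈-trans (+-cong (≈-refl {g ℤ.^ i}) (p*≈0 (+ suc i * + s))) (≡⇒≈ (ℤP.+-identityʳ (g ℤ.^ i)))

  value-next≈ : ∀ {i} s → i < P₁ → value (next (i , s)) ≈ g ℤ.^ suc i
  value-next≈ {i} s i<P₁ with next-cases i<P₁
  ... | inj₁ (_ , step)      rewrite step s = value≈ (suc i) s
  ... | inj₂ (i+1≡P₁ , wrap) rewrite wrap s = ≈-trans (value≈ 0 (suc s))
        (≈-sym (subst (λ e → g ℤ.^ e ≈ 1ℤ) (sym i+1≡P₁) (pow≈1 order-g)))

  difference≈ : ∀ {i} s → i < P₁ → difference (i , s) ≈ g ℤ.^ i * (1ℤ - g)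
  difference≈ {i} s i<P₁ = ≈-trans (-‿cong (value≈ i s) (value-next≈ s i<P₁)) (≡⇒≈ (factor (g ℤ.^ i) g))
    where factor : ∀ G g → G - g * G ≡ G * (1ℤ - g)
          factor = solve-∀

  -- 1 - g is a unit, since g ≉ 1 = g^0 as g has order p - 1 > 1.
  unit-1-g : Unit (1ℤ - g)
  unit-1-g 1-g≈0 = ℕP.0≢1+n (sym (pow-injective order-g unit-g 1<P₁ (ℕ.>-nonZero⁻¹ P₁) g¹≈g⁰))
    where g¹≈g⁰ : g ℤ.^ 1 ≈ g ℤ.^ 0
          g¹≈g⁰ = ≈-trans (≡⇒≈ (ℤP.*-identityʳ g)) (≈-sym (-≈0⇒≈ 1-g≈0))

  unit-value : ∀ i s → Unit (value (i , s))
  unit-value i s = unit-cong (≈-sym (value≈ i s)) (unit-^ i unit-g)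

  unit-difference : ∀ {i} s → i < P₁ → Unit (difference (i , s))
  unit-difference {i} s i<P₁ = unit-cong (≈-sym (difference≈ s i<P₁)) (unit-* (unit-^ i unit-g) unit-1-g)

  -- Modulo n, distinct positions carry incongruent values and differences:
  -- modulo p the row i is determined (g has order p - 1), and within a row
  -- two entries differ by p c (s - s') with c coprime to q.
  coprime-to-q : ∀ {c} → 0 < c → c < p → Coprime c q
  coprime-to-q 0<c c<p = coprime-^ʳ k (ℕC.sym (prime-coprime pr
    (λ p∣c → ℕP.<⇒≱ c<p (ℕD.∣⇒≤ {{ℕ.>-nonZero 0<c}} p∣c))))

  mod-p : ∀ {a b} → a ≈ₙ b → a ≈ b
  mod-p = ≈-weaken (ℕD.m∣m*n q)

  row<p : ∀ {i} → i < P₁ → suc i < p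
  row<p i<P₁ = ℕP.≤-<-trans i<P₁ p-1<p

  value-row-injective : ∀ {i s s′} → i < P₁ → s < q → s′ < q →
                        value (i , s) ≈ₙ value (i , s′) → s ≡ s′
  value-row-injective {i} {s} {s′} i<P₁ s<q s′<q e =
    cancel-scaled (+ suc i) p≢0 (coprime-to-q ℕ.z<s (row<p i<P₁)) s<q s′<q
      (subst (_≈ₙ 0ℤ) (within-row (g ℤ.^ i) (+ p) (+ i) (+ s) (+ s′)) (Modₙ.≈⇒-≈0 e))
    where within-row : ∀ G P I S S′ → (G + P * ((1ℤ + I) * S)) - (G + P * ((1ℤ + I) * S′)) ≡ P * ((1ℤ + I) * (S - S′))
          within-row = solve-∀

  value-injective : ∀ {i i′ s s′} → i < P₁ → i′ < P₁ → s < q → s′ < q →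
                    value (i , s) ≈ₙ value (i′ , s′) → (i , s) ≡ (i′ , s′)
  value-injective {i} {i′} {s} {s′} i<P₁ i′<P₁ s<q s′<q e =
    cong₂ _,_ i≡i′ (value-row-injective i′<P₁ s<q s′<q (subst (λ r → value (r , s) ≈ₙ value (i′ , s′)) i≡i′ e))
    where i≡i′ : i ≡ i′
          i≡i′ = pow-injective order-g unit-g i<P₁ i′<P₁
                   (≈-trans (≈-sym (value≈ i s)) (≈-trans (mod-p e) (value≈ i′ s′)))

  difference-row-injective : ∀ {i s s′} → i < P₁ → s < q → s′ < q →
                             difference (i , s) ≈ₙ difference (i , s′) → s ≡ s′
  difference-row-injective {i} {s} {s′} i<P₁ s<q s′<q e with next-cases i<P₁
  ... | inj₁ (_ , step) = cancel-scaled (- 1ℤ) p≢0 (λ (d∣1 , _) → ℕD.∣1⇒≡1 d∣1) s<q s′<q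
                            (subst (_≈ₙ 0ℤ) across (Modₙ.≈⇒-≈0 e))
    where
      across : (value (i , s) - value (next (i , s))) - (value (i , s′) - value (next (i , s′))) ≡
               + p * (- 1ℤ * (+ s - + s′))
      across rewrite step s | step s′ = identity (g ℤ.^ i) g (+ p) (+ i) (+ s) (+ s′)
        where identity : ∀ G g P I S S′ →
                (G + P * ((1ℤ + I) * S) - (g * G + P * ((1ℤ + (1ℤ + I)) * S))) -
                (G + P * ((1ℤ + I) * S′) - (g * G + P * ((1ℤ + (1ℤ + I)) * S′))) ≡ P * (- 1ℤ * (S - S′))
              identity = solve-∀
  ... | inj₂ (i+1≡P₁ , wrap) = cancel-scaled (+ i) p≢0 (coprime-to-q 0<i (ℕP.<-trans (ℕP.n<1+n i) (row<p i<P₁))) s<q s′<q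
                                 (subst (_≈ₙ 0ℤ) across (Modₙ.≈⇒-≈0 e))
    where
      0<i : 0 < i
      0<i = ℕ.s≤s⁻¹ (subst (1 <_) (sym i+1≡P₁) 1<P₁)
      across : (value (i , s) - value (next (i , s))) - (value (i , s′) - value (next (i , s′))) ≡
               + p * (+ i * (+ s - + s′))
      across rewrite wrap s | wrap s′ = identity (g ℤ.^ i) (+ p) (+ i) (+ s) (+ s′)
        where identity : ∀ G P I S S′ →
                (G + P * ((1ℤ + I) * S) - (1ℤ + P * (1ℤ * (1ℤ + S)))) -
                (G + P * ((1ℤ + I) * S′) - (1ℤ + P * (1ℤ * (1ℤ + S′)))) ≡ P * (I * (S - S′))
              identity = solve-∀

  difference-injective : ∀ {i i′ s s′} → i < P₁ → i′ < P₁ → s < q → s′ < q →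
                         difference (i , s) ≈ₙ difference (i′ , s′) → (i , s) ≡ (i′ , s′)
  difference-injective {i} {i′} {s} {s′} i<P₁ i′<P₁ s<q s′<q e =
    cong₂ _,_ i≡i′ (difference-row-injective i′<P₁ s<q s′<q
                     (subst (λ r → difference (r , s) ≈ₙ difference (i′ , s′)) i≡i′ e))
    where i≡i′ : i ≡ i′
          i≡i′ = pow-injective order-g unit-g i<P₁ i′<P₁ (cancelˡ unit-1-g
                   (subst₂ _≈_ (ℤP.*-comm (g ℤ.^ i) (1ℤ - g)) (ℤP.*-comm (g ℤ.^ i′) (1ℤ - g))
                     (≈-trans (≈-sym (difference≈ s i<P₁)) (≈-trans (mod-p e) (difference≈ s′ i′<P₁)))))

  m : ℕ
  m = q ℕ.* P₁

  coords-bound : ∀ {j} → j < m → proj₁ (coords j) < P₁ × proj₂ (coords j) < q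
  coords-bound {j} j<m = ℕDM.m%n<n j P₁ , ℕDM.m<n*o⇒m/o<n j<m

  coords-injective : ∀ {j j′} → coords j ≡ coords j′ → j ≡ j′
  coords-injective {j} {j′} eq = trans (ℕDM.m≡m%n+[m/n]*n j P₁)
    (trans (cong (λ c → proj₁ c ℕ.+ proj₂ c ℕ.* P₁) eq) (sym (ℕDM.m≡m%n+[m/n]*n j′ P₁)))

  -- Going once around the cycle of positions 0, …, m - 1, the difference of
  -- consecutive values is ≈ₙ difference (coords j): after the last position
  -- the next one, (0 , q), differs from position 0 = (0 , 0) by p q = n.
  cyclic-difference : ∀ {j j′} → (suc j < m × j′ ≡ suc j) ⊎ (suc j ≡ m × j′ ≡ 0) →
                      value (coords j) - value (coords j′) ≈ₙ difference (coords j)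
  cyclic-difference {j} (inj₁ (_ , refl)) =
    Modₙ.≡⇒≈ (cong (λ c → value (coords j) - value c) (coords-suc j))
  cyclic-difference {j} (inj₂ (j+1≡m , refl)) = Modₙ.-‿cong (Modₙ.≈-refl {value (coords j)}) (Modₙ.≈-sym last≈first)
    where
      last : next (coords j) ≡ (0 , q)
      last = trans (sym (coords-suc j)) (trans (cong coords j+1≡m) (coords-unique (ℕ.>-nonZero⁻¹ P₁)))
      first : coords 0 ≡ (0 , 0)
      first = coords-unique (ℕ.>-nonZero⁻¹ P₁)
      last≈first : value (next (coords j)) ≈ₙ value (coords 0)
      last≈first = subst₂ _≈ₙ_ (cong value (sym last)) (cong value (sym first))
                     (Modₙ.-≈0⇒≈ (subst (_≈ₙ 0ℤ) (sym gap) (Modₙ.*n≈0 1ℤ)))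
        where gap : value (0 , q) - value (0 , 0) ≡ 1ℤ * + n
              gap = trans (once-around (+ p) (+ q)) (trans (sym (ℤP.pos-* p q)) (sym (ℤP.*-identityˡ (+ n))))
                where once-around : ∀ P Q → 1ℤ + P * (1ℤ * Q) - (1ℤ + P * (1ℤ * 0ℤ)) ≡ P * Q
                      once-around = solve-∀

  φ≡m : φ n ≡ m
  φ≡m = PrimePowerTotient.φ-prime-power p k pr

  sequence : Fin (φ n) → ℤ
  sequence x = value (coords (Fin.toℕ x))

  position<m : ∀ (x : Fin (φ n)) → Fin.toℕ x < m
  position<m x = subst (Fin.toℕ x <_) φ≡m (FinP.toℕ<n x)

  reduced : (b : Fin (φ n) → ℤ) → (∀ x → Unit (b x)) → (∀ {x y} → b x ≈ₙ b y → x ≡ y) →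
            ReducedResidueSystem n b
  reduced b units injective =
    (λ x → unit⇒coprime (suc k) (units x)) , (λ x y x≢y e → x≢y (injective (Modₙ.≡[mod]⇒≈ e)))

  grid-injective : (f : Coord → ℤ) →
    (∀ {i i′ s s′} → i < P₁ → i′ < P₁ → s < q → s′ < q → f (i , s) ≈ₙ f (i′ , s′) → (i , s) ≡ (i′ , s′)) →
    ∀ {x y : Fin (φ n)} → f (coords (Fin.toℕ x)) ≈ₙ f (coords (Fin.toℕ y)) → x ≡ y
  grid-injective f f-injective {x} {y} e = FinP.toℕ-injective (coords-injective (f-injective
    (proj₁ (coords-bound (position<m x))) (proj₁ (coords-bound (position<m y)))
    (proj₂ (coords-bound (position<m x))) (proj₂ (coords-bound (position<m y))) e))

  reduced-values : ReducedResidueSystem n sequence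
  reduced-values = reduced sequence (λ x → unit-value (Fin.toℕ x ℕ.% P₁) (Fin.toℕ x ℕ./ P₁))
    (grid-injective value value-injective)

  differences≈ : ∀ x → cyclicDiffs sequence x ≈ₙ difference (coords (Fin.toℕ x))
  differences≈ x = cyclic-difference (Data.Sum.map (λ (j+1<φ , eq) → subst (suc (Fin.toℕ x) <_) φ≡m j+1<φ , eq)
                                                   (λ (j+1≡φ , eq) → trans j+1≡φ φ≡m , eq) (cyc-suc-cases x))

  reduced-differences : ReducedResidueSystem n (cyclicDiffs sequence)
  reduced-differences = reduced (cyclicDiffs sequence)
    (λ x → unit-cong (≈-sym (mod-p (differences≈ x)))
                     (unit-difference (Fin.toℕ x ℕ./ P₁) (proj₁ (coords-bound (position<m x)))))
    λ {x} {y} e → grid-injective difference difference-injective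
      (Modₙ.≈-trans (Modₙ.≈-sym (differences≈ x)) (Modₙ.≈-trans e (differences≈ y)))

theorem1p5 : (p k : ℕ) → Prime p → p ≢ 2 → 1 < p ^ k →
    Σ (Fin (φ (p ^ k)) → ℤ) λ a →
    ReducedResidueSystem (p ^ k) a × ReducedResidueSystem (p ^ k) (cyclicDiffs a)
theorem1p5 p zero    pr p≢2 1<1 = ⊥-elim (ℕP.<-irrefl refl 1<1)
theorem1p5 p (suc k) pr p≢2 _   = sequence , reduced-values , reduced-differences
  where open Construction p k pr p≢2
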